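{- Let $G$ be an undirected graph with non-negative edge weights, cellularly embedded on an orientable surface $\Sigma$ with exactly one boundary component $s^*$. Let $X$ be a minimum-weight separating subgraph of $G$, let $\gamma$ be a closed walk in $G$ lying in the closure of the component of $\Sigma\setminus X$ not incident to $s^*$, and let $H$ be a minimum-weight even subgraph $\mathbb{Z}_2$-homologous to $\gamma$. Then there is a minimum-weight separating subgraph $X'$ of $G$ (possibly $X$ itself) such that $H$ lies in the closure of the component of $\Sigma\setminus X'$ not incident to $s^*$.
   Context: A separating subgraph of $G$ is the boundary of the union of a non-empty set of faces of $G$ (the hole bounded by $s^*$ is not a face). For a minimum-weight separating subgraph $X$, the surface $\Sigma\setminus X$ has exactly one component not incident to $s^*$, which is what "the component not incident to $s^*$" refers to. An even subgraph is a set of edges with every vertex of even degree. A boundary subgraph is the symmetric difference of the boundary edge sets of some subset of faces; an even subgraph $H$ is $\mathbb{Z}_2$-homologous to a closed walk $\gamma$ if the symmetric difference of $H$ with the set of edges traversed an odd number of times by $\gamma$ is a boundary subgraph. Weights are sums of edge weights.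
   Formalization: The edge weights of G are non-negative rationals rather than non-negative reals. -}

module Defs where

open import Data.Bool using (Bool; true; false; not; _∧_; _xor_; if_then_else_)
open import Data.Nat using (ℕ; zero; suc; _*_; _%_)
open import Data.Fin using (Fin)
open import Data.Fin.Properties using () renaming (_≟_ to _≟F_)
open import Data.Bool.Properties using () renaming (_≟_ to _≟B_)
open import Data.Product using (Σ; _×_; _,_; proj₁; proj₂; ∃)
open import Data.Product.Properties using (≡-dec)
open import Data.Bool.ListAction using (any)
open import Data.List using (List; []; _∷_; upTo; allFin; concatMap; filter; length; foldr; map)
open import Data.Rational using (ℚ; 0ℚ; _+_; _≤_)
open import Relation.Nullary using (¬_; Dec; does)
open import Relation.Binary.PropositionalEquality using (_≡_)
open import Relation.Unary using (Decidable)

-- A dart is an edge with a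
-- direction.  rev reverses a dart.  σ is the rotation at vertices
-- (vertices = σ-orbits of darts, the vertex of a dart is its tail) and
-- faces are the orbits of φ = σ ∘ rev.  A rotation system on a connected
-- graph is exactly a cellular embedding in an orientable closed surface.

Dart : ℕ → Set
Dart m = Fin m × Bool

edge : ∀ {m} → Dart m → Fin m
edge = proj₁

rev : ∀ {m} → Dart m → Dart m
rev (e , b) = (e , not b)

_≟D_ : ∀ {m} (d d' : Dart m) → Dec (d ≡ d')
_≟D_ = ≡-dec _≟F_ _≟B_

iter : ∀ {A : Set} → (A → A) → ℕ → A → A
iter f zero x = x
iter f (suc k) x = f (iter f k x)

allDarts : ∀ m → List (Dart m)
allDarts m = concatMap (λ e → (e , true) ∷ (e , false) ∷ []) (allFin m)

-- d and d' lie in the same π-orbit (π a permutation of the 2m darts,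
-- so orbits have length ≤ 2m and the bounded search is exact)
sameOrbit : ∀ {m} → (Dart m → Dart m) → Dart m → Dart m → Bool
sameOrbit {m} π d d' = any (λ k → does (iter π k d ≟D d')) (upTo (2 * m))

data Conn {m} (σ : Dart m → Dart m) (d : Dart m) : Dart m → Set where
  here  : Conn σ d d
  stepσ : ∀ {d'} → Conn σ d d' → Conn σ d (σ d')
  stepr : ∀ {d'} → Conn σ d d' → Conn σ d (rev d')

-- A weighted graph G with m edges, cellularly embedded on an orientable
-- surface with one boundary component: a connected rotation system,
-- with a distinguished face s* (the face of the dart hole), which is
-- removed (the hole); the remaining faces are the faces of G.
record EmbGraph (m : ℕ) : Set where
  field
    σ      : Dart m → Dart m
    σ⁻¹    : Dart m → Dart m
    σσ⁻¹   : ∀ d → σ (σ⁻¹ d) ≡ d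
    σ⁻¹σ   : ∀ d → σ⁻¹ (σ d) ≡ d
    conn   : ∀ d d' → Conn σ d d'
    hole   : Dart m
    w      : Fin m → ℚ
    w≥0    : ∀ e → 0ℚ ≤ w e

module _ {m : ℕ} (G : EmbGraph m) where
  open EmbGraph G

  φ : Dart m → Dart m
  φ d = σ (rev d)

  sameVertex : Dart m → Dart m → Bool
  sameVertex = sameOrbit σ

  sameFace : Dart m → Dart m → Bool
  sameFace = sameOrbit φ

  Subgraph : Set
  Subgraph = Fin m → Bool

  weight : Subgraph → ℚ
  weight H = foldr (λ e acc → (if H e then w e else 0ℚ) + acc) 0ℚ (allFin m)

  -- a set of faces of G (the hole s* is not a face): a set of darts
  -- closed under φ (i.e. a union of φ-orbits) not containing the hole
  record FaceSet : Set where
    field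
      mem      : Dart m → Bool
      φ-closed : ∀ d → mem (φ d) ≡ mem d
      no-hole  : mem hole ≡ false

  ∂ : FaceSet → Subgraph
  ∂ U e = FaceSet.mem U (e , true) xor FaceSet.mem U (e , false)

  IsBoundarySubgraph : Subgraph → Set
  IsBoundarySubgraph H = Σ FaceSet λ U → ∀ e → H e ≡ ∂ U e

  IsSeparating : Subgraph → Set
  IsSeparating X =
    Σ FaceSet λ U → (∃ λ d → FaceSet.mem U d ≡ true) × (∀ e → X e ≡ ∂ U e)

  IsMinSeparating : Subgraph → Set
  IsMinSeparating X = IsSeparating X × (∀ Y → IsSeparating Y → weight X ≤ weight Y)

  degree : Subgraph → Dart m → ℕ
  degree H d = length (filter (λ d' → (sameVertex d d' ∧ H (edge d')) ≟B true) (allDarts m))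

  IsEven : Subgraph → Set
  IsEven H = ∀ d → degree H d % 2 ≡ 0

  -- closed walks: a base vertex (given by a dart at it) and a list of
  -- darts, each starting where the previous one ends, returning to base
  Chain : Dart m → List (Dart m) → Dart m → Set
  Chain v [] v' = sameVertex v v' ≡ true
  Chain v (d ∷ ds) v' = (sameVertex v d ≡ true) × Chain (rev d) ds v'

  record ClosedWalk : Set where
    field
      base   : Dart m
      darts  : List (Dart m)
      closed : Chain base darts base

  oddEdges : ClosedWalk → Subgraph
  oddEdges γ e =
    does (length (filter (λ d → edge d ≟F e) (ClosedWalk.darts γ)) % 2 Data.Nat.≟ 1)

  Homologous : Subgraph → ClosedWalk → Set
  Homologous H γ = IsBoundarySubgraph (λ e → H e xor oddEdges γ e)

  IsMinEvenHomologous : Subgraph → ClosedWalk → Set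
  IsMinEvenHomologous H γ =
    IsEven H × Homologous H γ ×
    (∀ H' → IsEven H' → Homologous H' γ → weight H ≤ weight H')

  -- Faces of Σ \ X (with the hole s* capped as its own region):
  -- Reach X d d' : the face of d' is reachable from the face of d without
  -- crossing an edge of X.  Components of Σ \ X correspond to these classes.
  data Reach (X : Subgraph) (d : Dart m) : Dart m → Set where
    here  : Reach X d d
    stepφ : ∀ {d'} → Reach X d d' → Reach X d (φ d')
    cross : ∀ {d'} → Reach X d d' → X (edge d') ≡ false → Reach X d (rev d')

  AwayFromHole : Subgraph → Dart m → Set
  AwayFromHole X d = ¬ Reach X hole d

  EdgeInClosure : Subgraph → Fin m → Set
  EdgeInClosure X e = Σ Bool λ b → AwayFromHole X (e , b)

  VertexInClosure : Subgraph → Dart m → Set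
  VertexInClosure X v = Σ (Dart m) λ d → (sameVertex v d ≡ true) × AwayFromHole X d

  data AllL {A : Set} (P : A → Set) : List A → Set where
    []  : AllL P []
    _∷_ : ∀ {x xs} → P x → AllL P xs → AllL P (x ∷ xs)

  WalkInClosure : Subgraph → ClosedWalk → Set
  WalkInClosure X γ =
    VertexInClosure X (ClosedWalk.base γ) ×
    AllL (λ d → EdgeInClosure X (edge d)) (ClosedWalk.darts γ)

  SubgraphInClosure : Subgraph → Subgraph → Set
  SubgraphInClosure X H = ∀ e → H e ≡ true → EdgeInClosure X e

-- Let A be the union of the faces that cannot be reached from the hole without crossing X,
-- so that ∂A ⊆ X and every edge traversed by γ has a side in A, and let V be a set of faces
-- with H ⊕ γ = ∂V.  Replace X by X′ = ∂(A ∪ V) and H by H′ = ∂(V ∖ A) ⊕ H.  Then X′ is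
-- separating, H′ is even and homologous to γ, and on every single edge X′ + H′ ≤ X + H.
-- Minimality of H gives w(H) ≤ w(H′), hence w(X′) ≤ w(X), so X′ is a minimum separating
-- subgraph; and every edge of H has a side in A ∪ V, i.e. lies in the closure of the
-- component of Σ ∖ X′ away from the hole.

module Submission where

open import Defs
open import Algebra.Bundles using (CommutativeMonoid; CommutativeRing)
open import Data.Bool using (Bool; true; false; not; _∧_; _∨_; _xor_; if_then_else_)
open import Data.Bool.ListAction using (any)
open import Data.Bool.Properties
  using (T-≡; T-not-≡; T-∧; ∨-zeroʳ; xor-same; xor-comm; xor-assoc; xor-identityʳ; ∧-distribˡ-xor;
         xor-∧-commutativeRing)
  renaming (_≟_ to _≟ᵇ_)
open import Data.Fin as Fin using (Fin; toℕ; combine)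
open import Data.Fin.Properties using (injective⇒≤; pigeonhole; toℕ≤pred[n]; combine-injective; 2↔Bool)
  renaming (_≟_ to _≟ᶠ_)
open import Data.List using (List; []; _∷_; length; filter; map; lookup; foldr; upTo; allFin; concatMap; cartesianProduct)
open import Data.List.Properties using (length-map)
open import Data.List.Membership.Propositional using (_∈_; find; lose)
open import Data.List.Membership.Propositional.Properties
  using (∈-lookup; ∈-filter⁺; ∈-filter⁻; ∈-map⁻; ∈-upTo⁺; ∈-allFin; ∈-cartesianProduct⁺)
open import Data.List.Relation.Binary.Subset.Propositional using (_⊆_)
open import Data.List.Relation.Unary.All as All using ([]; _∷_)
open import Data.List.Relation.Unary.AllPairs using ([]; _∷_)
open import Data.List.Relation.Unary.Any using (here; there; index; any?)
open import Data.List.Relation.Unary.Any.Properties using (lookup-index; any⁺; any⁻)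
open import Data.List.Relation.Unary.Unique.Propositional using (Unique)
import Data.List.Relation.Unary.Unique.Propositional.Properties as Unique
open import Data.Nat using (ℕ; zero; suc; _+_; _*_; _≤_; _<_; _/_; _%_; z≤n; s≤s)
open import Data.Nat.DivMod using (m≡m%n+[m/n]*n; m%n<n)
open import Data.Nat.Divisibility using (_∣_; ∣m∣n⇒∣m+n; ∣m+n∣m⇒∣n; m∣m*n; m%n≡0⇔n∣m)
open import Data.Nat.Properties
  using (≤-refl; ≤-trans; ≤-reflexive; ≤-antisym; <-≤-trans; <-irrefl; n<1+n; m≤n+m; +-suc; +-identityʳ;
         +-mono-≤; +-mono-≤-<; *-distribˡ-+; m≤n⇒∃[o]m+o≡n; +-commutativeSemigroup; module ≤-Reasoning)
open import Data.Product using (Σ; ∃-syntax; _×_; _,_; proj₁; proj₂)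
open import Data.Rational using (ℚ; 0ℚ; -_) renaming (_+_ to _+ℚ_; _≤_ to _≤ℚ_)
import Data.Rational.Properties as ℚ
open import Data.Sum using (_⊎_; inj₁; inj₂)
open import Function using (_∘_; Injective)
open import Function.Bundles using (Inverse; Equivalence; _⇔_; mk⇔)
open import Level using (0ℓ)
open import Relation.Binary using (Rel; Decidable; DecidableEquality)
open import Relation.Binary.Construct.Closure.ReflexiveTransitive using (Star; ε; _◅_; _◅◅_)
open import Relation.Binary.PropositionalEquality
open import Relation.Nullary using (Dec; yes; no; does; contradiction; _⊎-dec_; _×-dec_)
open import Relation.Nullary.Decidable using (T?; dec-true; dec-false; does-⇔; map′)
open import Algebra.Properties.CommutativeSemigroup +-commutativeSemigroup
  using () renaming (interchange to +-interchange)
open import Algebra.Properties.CommutativeSemigroup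
  (CommutativeMonoid.commutativeSemigroup ℚ.+-0-commutativeMonoid)
  using () renaming (interchange to +ℚ-interchange)
open import Algebra.Properties.CommutativeSemigroup
  (CommutativeRing.+-commutativeSemigroup xor-∧-commutativeRing)
  using () renaming (interchange to xor-interchange)
open import Algebra.Properties.Monoid.Mult ℚ.+-0-monoid using (×-homo-1; ×-homo-+) renaming (_×_ to _×ℚ_)

≡true⇔≡true⇒≡ : ∀ {a b} → (a ≡ true → b ≡ true) → (b ≡ true → a ≡ true) → a ≡ b
≡true⇔≡true⇒≡ {false} {false} _   _   = refl
≡true⇔≡true⇒≡ {false} {true}  _   b⇒a = b⇒a refl
≡true⇔≡true⇒≡ {true}  {false} a⇒b _   = sym (a⇒b refl)
≡true⇔≡true⇒≡ {true}  {true}  _   _   = refl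

xor≡false⇒≡ : ∀ {a b} → a xor b ≡ false → a ≡ b
xor≡false⇒≡ {false} {false} _ = refl
xor≡false⇒≡ {true}  {true}  _ = refl

xor-cancelʳ : ∀ a b c → a xor b ≡ c → a ≡ c xor b
xor-cancelʳ a b c a⊕b≡c = begin
  a                ≡⟨ xor-identityʳ a ⟨
  a xor false      ≡⟨ cong (a xor_) (xor-same b) ⟨
  a xor (b xor b)  ≡⟨ xor-assoc a b b ⟨
  (a xor b) xor b  ≡⟨ cong (_xor b) a⊕b≡c ⟩
  c xor b          ∎
  where open ≡-Reasoning

does≡true⇒ : ∀ {P : Set} (P? : Dec P) → does P? ≡ true → P
does≡true⇒ (yes p) _ = p

bit : Bool → ℕ
bit true  = 1
bit false = 0

bit≤1 : ∀ a → bit a ≤ 1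
bit≤1 false = z≤n
bit≤1 true  = ≤-refl

bit-mono : ∀ {a b} → (a ≡ true → b ≡ true) → bit a ≤ bit b
bit-mono {false} _   = z≤n
bit-mono {true}  a⇒b rewrite a⇒b refl = ≤-refl

bit-xor : ∀ a b → 2 * bit (a ∧ b) + bit (a xor b) ≡ bit a + bit b
bit-xor false b     = refl
bit-xor true  true  = refl
bit-xor true  false = refl

bit-not≤suc : ∀ b → bit (not b) ≤ suc (bit b)
bit-not≤suc true  = z≤n
bit-not≤suc false = ≤-refl

module _ {A : Set} where

  any≡true⇒ : ∀ (p : A → Bool) xs → any p xs ≡ true → ∃[ x ] x ∈ xs × p x ≡ true
  any≡true⇒ p xs any≡true with find (any⁻ p xs (Equivalence.from T-≡ any≡true))
  ... | x , x∈xs , px = x , x∈xs , Equivalence.to T-≡ px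

  ∈⇒any≡true : ∀ (p : A → Bool) {x xs} → x ∈ xs → p x ≡ true → any p xs ≡ true
  ∈⇒any≡true p x∈xs px = Equivalence.to T-≡ (any⁺ p (lose x∈xs (Equivalence.from T-≡ px)))

  count : (A → Bool) → List A → ℕ
  count P []       = 0
  count P (x ∷ xs) = bit (P x) + count P xs

  length-filter≡count : ∀ (P : A → Bool) xs → length (filter (λ x → P x ≟ᵇ true) xs) ≡ count P xs
  length-filter≡count P []       = refl
  length-filter≡count P (x ∷ xs) with P x
  ... | true  = cong suc (length-filter≡count P xs)
  ... | false = length-filter≡count P xs

  count-cong : ∀ {P Q : A → Bool} → (∀ x → P x ≡ Q x) → ∀ xs → count P xs ≡ count Q xs
  count-cong P≗Q []       = refl
  count-cong P≗Q (x ∷ xs) = cong₂ _+_ (cong bit (P≗Q x)) (count-cong P≗Q xs)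

  count≤length : ∀ P (xs : List A) → count P xs ≤ length xs
  count≤length P []       = z≤n
  count≤length P (x ∷ xs) = +-mono-≤ (bit≤1 (P x)) (count≤length P xs)

  count-mono : ∀ {P Q : A → Bool} → (∀ x → P x ≡ true → Q x ≡ true) → ∀ xs → count P xs ≤ count Q xs
  count-mono P⊆Q []       = z≤n
  count-mono P⊆Q (x ∷ xs) = +-mono-≤ (bit-mono (P⊆Q x)) (count-mono P⊆Q xs)

  count-mono-< : ∀ {P Q : A → Bool} → (∀ x → P x ≡ true → Q x ≡ true) →
                 ∀ {y xs} → y ∈ xs → Q y ≡ true → P y ≡ false → count P xs < count Q xs
  count-mono-< P⊆Q {xs = _ ∷ xs} (here refl) Qy Py rewrite Qy | Py = s≤s (count-mono P⊆Q xs)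
  count-mono-< P⊆Q {xs = x ∷ _}  (there y∈xs) Qy Py =
    +-mono-≤-< (bit-mono (P⊆Q x)) (count-mono-< P⊆Q y∈xs Qy Py)

  count-xor : ∀ (P Q : A → Bool) xs →
              2 * count (λ x → P x ∧ Q x) xs + count (λ x → P x xor Q x) xs ≡ count P xs + count Q xs
  count-xor P Q []       = refl
  count-xor P Q (x ∷ xs) = begin
    2 * (bit (P x ∧ Q x) + c∧) + (bit (P x xor Q x) + c⊕)
      ≡⟨ cong (_+ (bit (P x xor Q x) + c⊕)) (*-distribˡ-+ 2 (bit (P x ∧ Q x)) c∧) ⟩
    (2 * bit (P x ∧ Q x) + 2 * c∧) + (bit (P x xor Q x) + c⊕)
      ≡⟨ +-interchange (2 * bit (P x ∧ Q x)) (2 * c∧) (bit (P x xor Q x)) c⊕ ⟩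
    (2 * bit (P x ∧ Q x) + bit (P x xor Q x)) + (2 * c∧ + c⊕)
      ≡⟨ cong₂ _+_ (bit-xor (P x) (Q x)) (count-xor P Q xs) ⟩
    (bit (P x) + bit (Q x)) + (count P xs + count Q xs)
      ≡⟨ +-interchange (bit (P x)) (bit (Q x)) (count P xs) (count Q xs) ⟩
    (bit (P x) + count P xs) + (bit (Q x) + count Q xs) ∎
    where
    open ≡-Reasoning
    c∧ = count (λ x → P x ∧ Q x) xs
    c⊕ = count (λ x → P x xor Q x) xs

  count-xor-even : ∀ (P Q : A → Bool) xs →
                   2 ∣ count P xs + count Q xs → 2 ∣ count (λ x → P x xor Q x) xs
  count-xor-even P Q xs 2∣P+Q =
    ∣m+n∣m⇒∣n (subst (2 ∣_) (sym (count-xor P Q xs)) 2∣P+Q) (m∣m*n (count (λ x → P x ∧ Q x) xs))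

  lookup-injective : ∀ {xs : List A} → Unique xs → ∀ {i j} → lookup xs i ≡ lookup xs j → i ≡ j
  lookup-injective (_  ∷ _) {Fin.zero}  {Fin.zero}  _  = refl
  lookup-injective (x∉ ∷ _) {Fin.zero}  {Fin.suc j} eq = contradiction eq (All.lookup x∉ (∈-lookup j))
  lookup-injective (x∉ ∷ _) {Fin.suc i} {Fin.zero}  eq = contradiction (sym eq) (All.lookup x∉ (∈-lookup i))
  lookup-injective (_  ∷ u) {Fin.suc i} {Fin.suc j} eq = cong Fin.suc (lookup-injective u eq)

  Unique-⊆⇒length≤ : ∀ {xs ys : List A} → Unique xs → xs ⊆ ys → length xs ≤ length ys
  Unique-⊆⇒length≤ {xs} {ys} u xs⊆ys = injective⇒≤ position-injective
    where
    position : Fin (length xs) → Fin (length ys)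
    position i = index (xs⊆ys (∈-lookup i))

    position-injective : ∀ {i j} → position i ≡ position j → i ≡ j
    position-injective {i} {j} eq = lookup-injective u (begin
      lookup xs i            ≡⟨ lookup-index (xs⊆ys (∈-lookup i)) ⟩
      lookup ys (position i) ≡⟨ cong (lookup ys) eq ⟩
      lookup ys (position j) ≡⟨ lookup-index (xs⊆ys (∈-lookup j)) ⟨
      lookup xs j            ∎)
      where open ≡-Reasoning

  module _ {xs : List A} (xs-unique : Unique xs) (xs-complete : ∀ x → x ∈ xs) where

    count-∘-injective : ∀ {f : A → A} → Injective _≡_ _≡_ f → ∀ P → count (P ∘ f) xs ≤ count P xs
    count-∘-injective {f} f-injective P =
      subst₂ _≤_ (trans (length-map f (accepted (P ∘ f))) (length-filter≡count (P ∘ f) xs))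
                 (length-filter≡count P xs)
        (Unique-⊆⇒length≤ (Unique.map⁺ f-injective (Unique.filter⁺ (λ x → P (f x) ≟ᵇ true) {xs} xs-unique))
                          image⊆)
      where
      accepted : (A → Bool) → List A
      accepted Q = filter (λ x → Q x ≟ᵇ true) xs

      image⊆ : map f (accepted (P ∘ f)) ⊆ accepted P
      image⊆ y∈ with ∈-map⁻ f y∈
      ... | x , x∈ , refl = ∈-filter⁺ (λ y → P y ≟ᵇ true) (xs-complete (f x))
                                      (proj₂ (∈-filter⁻ (λ y → P (f y) ≟ᵇ true) {xs = xs} x∈))

    count-∘-inverse : ∀ {f g : A → A} → (∀ x → g (f x) ≡ x) → (∀ x → f (g x) ≡ x) →
                      ∀ P → count (P ∘ f) xs ≡ count P xs
    count-∘-inverse {f} {g} g∘f f∘g P = ≤-antisym (count-∘-injective (injective {f} {g} g∘f) P) (begin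
      count P xs           ≡⟨ count-cong (λ x → cong P (sym (f∘g x))) xs ⟩
      count (P ∘ f ∘ g) xs ≤⟨ count-∘-injective (injective {g} {f} f∘g) (P ∘ f) ⟩
      count (P ∘ f) xs     ∎)
      where
      open ≤-Reasoning
      injective : ∀ {h k : A → A} → (∀ x → k (h x) ≡ x) → Injective _≡_ _≡_ h
      injective {h} {k} k∘h {x} {y} eq = trans (sym (k∘h x)) (trans (cong k eq) (k∘h y))

module _ {A : Set} (f : A → A) where

  iter-+ : ∀ a b x → iter f (a + b) x ≡ iter f a (iter f b x)
  iter-+ zero    b x = refl
  iter-+ (suc a) b x = cong f (iter-+ a b x)

  iter-suc : ∀ k x → iter f k (f x) ≡ iter f (suc k) x
  iter-suc zero    x = refl
  iter-suc (suc k) x = cong f (iter-suc k x)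

  iter-*-period : ∀ {p x} → iter f p x ≡ x → ∀ j → iter f (j * p) x ≡ x
  iter-*-period fᵖx≡x zero    = refl
  iter-*-period {p} {x} fᵖx≡x (suc j) =
    trans (iter-+ p (j * p) x) (trans (cong (iter f p) (iter-*-period fᵖx≡x j)) fᵖx≡x)

  iter-%-period : ∀ {q x} → iter f (suc q) x ≡ x → ∀ k → iter f (k % suc q) x ≡ iter f k x
  iter-%-period {q} {x} period k = begin
    iter f (k % p) x                    ≡⟨ cong (iter f (k % p)) (iter-*-period period (k / p)) ⟨
    iter f (k % p) (iter f (k / p * p) x) ≡⟨ iter-+ (k % p) (k / p * p) x ⟨
    iter f (k % p + k / p * p) x        ≡⟨ cong (λ n → iter f n x) (m≡m%n+[m/n]*n k p) ⟨
    iter f k x                          ∎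
    where
    open ≡-Reasoning
    p = suc q

  module _ (f-injective : Injective _≡_ _≡_ f) where

    iter-injective : ∀ k {x y} → iter f k x ≡ iter f k y → x ≡ y
    iter-injective zero    eq = eq
    iter-injective (suc k) eq = iter-injective k (f-injective eq)

    period : ∀ {n} {enc : A → Fin n} → Injective _≡_ _≡_ enc →
             ∀ x → ∃[ q ] suc q ≤ n × iter f (suc q) x ≡ x
    period {n} {enc} enc-injective x
      with i , j , i<j , same-code ← pigeonhole (n<1+n n) (λ i → enc (iter f (toℕ i) x))
      with q , i+1+q≡j ← m≤n⇒∃[o]m+o≡n i<j
      = q , ≤-trans (m≤n+m (suc q) (toℕ i)) (≤-trans (≤-reflexive i+p≡j) (toℕ≤pred[n] j))
          , sym (iter-injective (toℕ i) fⁱx≡fⁱfᵖx)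
      where
      open ≡-Reasoning
      i+p≡j : toℕ i + suc q ≡ toℕ j
      i+p≡j = trans (+-suc (toℕ i) q) i+1+q≡j

      fⁱx≡fⁱfᵖx : iter f (toℕ i) x ≡ iter f (toℕ i) (iter f (suc q) x)
      fⁱx≡fⁱfᵖx = begin
        iter f (toℕ i) x                  ≡⟨ enc-injective same-code ⟩
        iter f (toℕ j) x                  ≡⟨ cong (λ n → iter f n x) i+p≡j ⟨
        iter f (toℕ i + suc q) x          ≡⟨ iter-+ (toℕ i) (suc q) x ⟩
        iter f (toℕ i) (iter f (suc q) x) ∎

module _ {m : ℕ} where

  rev-involutive : ∀ (d : Dart m) → rev (rev d) ≡ d
  rev-involutive (e , true)  = refl
  rev-involutive (e , false) = refl

  concatMap-darts≡cartesianProduct : ∀ (es : List (Fin m)) →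
    concatMap (λ e → (e , true) ∷ (e , false) ∷ []) es ≡ cartesianProduct es (true ∷ false ∷ [])
  concatMap-darts≡cartesianProduct []       = refl
  concatMap-darts≡cartesianProduct (e ∷ es) =
    cong (λ ds → (e , true) ∷ (e , false) ∷ ds) (concatMap-darts≡cartesianProduct es)

  allDarts-unique : Unique (allDarts m)
  allDarts-unique rewrite concatMap-darts≡cartesianProduct (allFin m) =
    Unique.cartesianProduct⁺ (Unique.allFin⁺ m) (((λ ()) ∷ []) ∷ [] ∷ [])

  allDarts-complete : ∀ d → d ∈ allDarts m
  allDarts-complete (e , b) rewrite concatMap-darts≡cartesianProduct (allFin m) =
    ∈-cartesianProduct⁺ (∈-allFin e) (bool∈ b)
    where
    bool∈ : ∀ b → b ∈ true ∷ false ∷ []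
    bool∈ true  = here refl
    bool∈ false = there (here refl)

  encode : Dart m → Fin (2 * m)
  encode (e , b) = combine (Inverse.from 2↔Bool b) e

  encode-injective : Injective _≡_ _≡_ encode
  encode-injective {e , b} {e′ , b′} eq
    with b≡b′ , refl ← combine-injective (Inverse.from 2↔Bool b) e (Inverse.from 2↔Bool b′) e′ eq
    = cong (e ,_) (begin
      b                                          ≡⟨ Inverse.strictlyInverseˡ 2↔Bool b ⟨
      Inverse.to 2↔Bool (Inverse.from 2↔Bool b)  ≡⟨ cong (Inverse.to 2↔Bool) b≡b′ ⟩
      Inverse.to 2↔Bool (Inverse.from 2↔Bool b′) ≡⟨ Inverse.strictlyInverseˡ 2↔Bool b′ ⟩
      b′                                         ∎)
    where open ≡-Reasoning

  -- sameOrbit only searches the first 2m iterates; since every orbit has period at most 2m,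
  -- it nevertheless decides membership in the full orbit.
  module _ {π : Dart m → Dart m} (π-injective : Injective _≡_ _≡_ π) where

    sameOrbit⇒iter : ∀ {d x} → sameOrbit π d x ≡ true → ∃[ k ] iter π k d ≡ x
    sameOrbit⇒iter {d} {x} orbit with any≡true⇒ _ (upTo (2 * m)) orbit
    ... | k , _ , πᵏd≟x = k , does≡true⇒ (iter π k d ≟D x) πᵏd≟x

    iter⇒sameOrbit : ∀ {d x} k → iter π k d ≡ x → sameOrbit π d x ≡ true
    iter⇒sameOrbit {d} {x} k πᵏd≡x with period π π-injective encode-injective d
    ... | q , p≤2m , πᵖd≡d =
      ∈⇒any≡true (λ i → does (iter π i d ≟D x)) (∈-upTo⁺ (<-≤-trans (m%n<n k (suc q)) p≤2m))
        (dec-true (iter π (k % suc q) d ≟D x) (trans (iter-%-period π πᵖd≡d k) πᵏd≡x))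

    sameOrbit-π : ∀ d x → sameOrbit π d (π x) ≡ sameOrbit π d x
    sameOrbit-π d x = ≡true⇔≡true⇒≡ backward forward
      where
      backward : sameOrbit π d (π x) ≡ true → sameOrbit π d x ≡ true
      backward orbit with sameOrbit⇒iter orbit
      ... | suc k , πᵏ⁺¹d≡πx = iter⇒sameOrbit k (π-injective πᵏ⁺¹d≡πx)
      ... | zero  , d≡πx with period π π-injective encode-injective x
      ... | q , _ , πᵖx≡x =
        iter⇒sameOrbit q (trans (cong (iter π q) d≡πx) (trans (iter-suc π q x) πᵖx≡x))

      forward : sameOrbit π d x ≡ true → sameOrbit π d (π x) ≡ true
      forward orbit with sameOrbit⇒iter orbit
      ... | k , πᵏd≡x = iter⇒sameOrbit (suc k) (cong π πᵏd≡x)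

module _ {A : Set} {enum : List A} (enum-complete : ∀ x → x ∈ enum) where

  -- While S has not stabilised, the number of elements satisfying S n grows with n; it is
  -- bounded by the size of the enumeration.
  stabilises : (S : ℕ → A → Bool) → (∀ n x → S n x ≡ true → S (suc n) x ≡ true) →
               ∃[ N ] ∀ x → S (suc N) x ≡ S N x
  stabilises S S-increasing with stable-or-large (suc (length enum))
    where
    stable-or-large : ∀ n → (∃[ N ] ∀ x → S (suc N) x ≡ S N x) ⊎ n ≤ count (S n) enum
    stable-or-large zero = inj₂ z≤n
    stable-or-large (suc n) with stable-or-large n
    ... | inj₁ stable = inj₁ stable
    ... | inj₂ n≤∣Sₙ∣ with any? (λ y → T? (S (suc n) y ∧ not (S n y))) enum
    ... | yes new with find new
    ...   | y , y∈enum , Sₙ₊₁y∧¬Sₙy with Equivalence.to T-∧ Sₙ₊₁y∧¬Sₙy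
    ...   | Sₙ₊₁y , ¬Sₙy = inj₂ (≤-trans (s≤s n≤∣Sₙ∣)
            (count-mono-< (S-increasing n) y∈enum (Equivalence.to T-≡ Sₙ₊₁y) (Equivalence.to T-not-≡ ¬Sₙy)))
    stable-or-large (suc n) | inj₂ _ | no ¬new =
      inj₁ (n , λ x → ≡true⇔≡true⇒≡ (old x) (S-increasing n x))
      where
      old : ∀ x → S (suc n) x ≡ true → S n x ≡ true
      old x Sₙ₊₁x with S n x in Sₙx
      ... | true  = refl
      ... | false = contradiction (lose (enum-complete x)
          (Equivalence.from T-∧ (Equivalence.from T-≡ Sₙ₊₁x , Equivalence.from T-not-≡ Sₙx))) ¬new
  ... | inj₁ stable = stable
  ... | inj₂ large  = contradiction (≤-trans large (count≤length (S (suc (length enum))) enum)) (<-irrefl refl)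

module _ {A : Set} (_≟_ : DecidableEquality A) {enum : List A} (enum-complete : ∀ x → x ∈ enum)
         {R : Rel A 0ℓ} (R? : Decidable R) (s : A) where

  reachedWithin : ℕ → A → Bool
  reachedWithin zero    x = does (s ≟ x)
  reachedWithin (suc n) x = reachedWithin n x ∨ any (λ y → reachedWithin n y ∧ does (R? y x)) enum

  reachedWithin-suc : ∀ n x → reachedWithin n x ≡ true → reachedWithin (suc n) x ≡ true
  reachedWithin-suc n x r = cong (_∨ any (λ y → reachedWithin n y ∧ does (R? y x)) enum) r

  reachedWithin-sound : ∀ n {x} → reachedWithin n x ≡ true → Star R s x
  reachedWithin-sound zero    {x} r with s ≟ x
  ... | yes refl = ε
  reachedWithin-sound (suc n) {x} r with reachedWithin n x in rₙx
  ... | true  = reachedWithin-sound n rₙx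
  ... | false with any≡true⇒ _ enum r
  ... | y , _ , _ with reachedWithin n y in rₙy | R? y x
  ... | true | yes Ryx = reachedWithin-sound n rₙy ◅◅ (Ryx ◅ ε)

  reachedWithin-start : ∀ n → reachedWithin n s ≡ true
  reachedWithin-start zero    = dec-true (s ≟ s) refl
  reachedWithin-start (suc n) = reachedWithin-suc n s (reachedWithin-start n)

  private
    stable : ∃[ N ] ∀ x → reachedWithin (suc N) x ≡ reachedWithin N x
    stable = stabilises enum-complete reachedWithin reachedWithin-suc

    N : ℕ
    N = proj₁ stable

    reached-step : ∀ {y x} → reachedWithin N y ≡ true → R y x → reachedWithin N x ≡ true
    reached-step {y} {x} rᴺy Ryx = begin
      reachedWithin N x ≡⟨ proj₂ stable x ⟨
      reachedWithin N x ∨ any (λ z → reachedWithin N z ∧ does (R? z x)) enum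
        ≡⟨ cong (reachedWithin N x ∨_)
                (∈⇒any≡true _ (enum-complete y) (cong₂ _∧_ rᴺy (dec-true (R? y x) Ryx))) ⟩
      reachedWithin N x ∨ true ≡⟨ ∨-zeroʳ _ ⟩
      true ∎
      where open ≡-Reasoning

    reached-complete : ∀ {y x} → reachedWithin N y ≡ true → Star R y x → reachedWithin N x ≡ true
    reached-complete rᴺy ε          = rᴺy
    reached-complete rᴺy (Ryz ◅ rs) = reached-complete (reached-step rᴺy Ryz) rs

  Star-decidable : ∀ x → Dec (Star R s x)
  Star-decidable x with reachedWithin N x in rᴺx
  ... | true  = yes (reachedWithin-sound N rᴺx)
  ... | false = no λ s⋆x →
    contradiction (trans (sym rᴺx) (reached-complete (reachedWithin-start N) s⋆x)) λ ()

×-nonNeg : ∀ {x} → 0ℚ ≤ℚ x → ∀ n → 0ℚ ≤ℚ n ×ℚ x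
×-nonNeg 0≤x zero        = ℚ.≤-refl
×-nonNeg {x} 0≤x (suc n) = subst (_≤ℚ x +ℚ n ×ℚ x) (ℚ.+-identityˡ 0ℚ) (ℚ.+-mono-≤ 0≤x (×-nonNeg 0≤x n))

×-monoˡ-≤ : ∀ {x} → 0ℚ ≤ℚ x → ∀ {m n} → m ≤ n → m ×ℚ x ≤ℚ n ×ℚ x
×-monoˡ-≤ 0≤x {n = n} z≤n   = ×-nonNeg 0≤x n
×-monoˡ-≤ {x} 0≤x (s≤s m≤n) = ℚ.+-monoʳ-≤ x (×-monoˡ-≤ 0≤x m≤n)

select≡bit× : ∀ b x → (if b then x else 0ℚ) ≡ bit b ×ℚ x
select≡bit× true  x = sym (×-homo-1 x)
select≡bit× false x = refl

select+select≡× : ∀ a b x → (if a then x else 0ℚ) +ℚ (if b then x else 0ℚ) ≡ (bit a + bit b) ×ℚ x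
select+select≡× a b x =
  trans (cong₂ _+ℚ_ (select≡bit× a x) (select≡bit× b x)) (sym (×-homo-+ x (bit a) (bit b)))

+-cancelʳ-≤ : ∀ a b c → a +ℚ c ≤ℚ b +ℚ c → a ≤ℚ b
+-cancelʳ-≤ a b c a+c≤b+c = subst₂ _≤ℚ_ (+c-c a) (+c-c b) (ℚ.+-monoˡ-≤ (- c) a+c≤b+c)
  where
  +c-c : ∀ x → (x +ℚ c) +ℚ - c ≡ x
  +c-c x = trans (ℚ.+-assoc x c (- c)) (trans (cong (x +ℚ_) (ℚ.+-inverseʳ c)) (ℚ.+-identityʳ x))

module _ {E : Set} (w : E → ℚ) (w≥0 : ∀ e → 0ℚ ≤ℚ w e) where

  wsum : (E → Bool) → List E → ℚ
  wsum K = foldr (λ e acc → (if K e then w e else 0ℚ) +ℚ acc) 0ℚ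

  wsum-exchange : ∀ {K₁ K₂ L₁ L₂ : E → Bool} →
                  (∀ e → bit (K₁ e) + bit (K₂ e) ≤ bit (L₁ e) + bit (L₂ e)) →
                  ∀ es → wsum K₁ es +ℚ wsum K₂ es ≤ℚ wsum L₁ es +ℚ wsum L₂ es
  wsum-exchange pointwise []       = ℚ.≤-refl
  wsum-exchange {K₁} {K₂} {L₁} {L₂} pointwise (e ∷ es) = begin
    (sel K₁ +ℚ wsum K₁ es) +ℚ (sel K₂ +ℚ wsum K₂ es)
      ≡⟨ +ℚ-interchange (sel K₁) (wsum K₁ es) (sel K₂) (wsum K₂ es) ⟩
    (sel K₁ +ℚ sel K₂) +ℚ (wsum K₁ es +ℚ wsum K₂ es)
      ≤⟨ ℚ.+-mono-≤ at-e (wsum-exchange {K₁} {K₂} {L₁} {L₂} pointwise es) ⟩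
    (sel L₁ +ℚ sel L₂) +ℚ (wsum L₁ es +ℚ wsum L₂ es)
      ≡⟨ +ℚ-interchange (sel L₁) (sel L₂) (wsum L₁ es) (wsum L₂ es) ⟩
    (sel L₁ +ℚ wsum L₁ es) +ℚ (sel L₂ +ℚ wsum L₂ es) ∎
    where
    open ℚ.≤-Reasoning
    sel : (E → Bool) → ℚ
    sel K = if K e then w e else 0ℚ
    at-e : sel K₁ +ℚ sel K₂ ≤ℚ sel L₁ +ℚ sel L₂
    at-e = subst₂ _≤ℚ_ (sym (select+select≡× (K₁ e) (K₂ e) (w e))) (sym (select+select≡× (L₁ e) (L₂ e) (w e)))
                  (×-monoˡ-≤ (w≥0 e) (pointwise e))

-- For an edge whose two sides lie in A (aᵗ, aᶠ) and in V (vᵗ, vᶠ), which γ traverses an odd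
-- number of times iff g, and with x = X e and h = H e: the new subgraphs ∂(A ∪ V) and
-- ∂(V ∖ A) ⊕ H use it at most as often as X and H together.
exchange-cost : ∀ aᵗ aᶠ vᵗ vᶠ g x h → h ≡ (vᵗ xor vᶠ) xor g →
                (x ≡ false → aᵗ xor aᶠ ≡ false) → (g ≡ true → aᵗ ∨ aᶠ ≡ true) →
                bit ((aᵗ ∨ vᵗ) xor (aᶠ ∨ vᶠ)) + bit (((not aᵗ ∧ vᵗ) xor (not aᶠ ∧ vᶠ)) xor h) ≤ bit x + bit h
exchange-cost true  true  _     _     _     x h _    _  _  = m≤n+m (bit h) (bit x)
exchange-cost false false _     _     true  _ _ _    _  Γ⊆ = contradiction (Γ⊆ refl) λ ()
exchange-cost false false true  true  false _ _ refl _  _  = z≤n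
exchange-cost false false true  false false x _ refl _  _  = m≤n+m 1 (bit x)
exchange-cost false false false true  false x _ refl _  _  = m≤n+m 1 (bit x)
exchange-cost false false false false false _ _ refl _  _  = z≤n
exchange-cost true  false _     _     _ false _ _    ∂⊆ _  = contradiction (∂⊆ refl) λ ()
exchange-cost true  false _     true  _ true  h _    _  _  = bit-not≤suc h
exchange-cost true  false _     false _ true  _ _    _  _  = ≤-refl
exchange-cost false true  _     _     _ false _ _    ∂⊆ _  = contradiction (∂⊆ refl) λ ()
exchange-cost false true  true  _     _ true  h _    _  _  = bit-not≤suc h
exchange-cost false true  false _     _ true  _ _    _  _  = ≤-refl

some-side : ∀ aᵗ aᶠ vᵗ vᶠ g → (g ≡ true → aᵗ ∨ aᶠ ≡ true) → (vᵗ xor vᶠ) xor g ≡ true →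
            aᵗ ∨ vᵗ ≡ true ⊎ aᶠ ∨ vᶠ ≡ true
some-side true  _     _     _     _ _  _       = inj₁ refl
some-side false _     true  _     _ _  _       = inj₁ refl
some-side false true  false _     _ _  _       = inj₂ refl
some-side false false false true  _ _  _       = inj₂ refl
some-side false false false false g Γ⊆ g≡true = contradiction (Γ⊆ g≡true) λ ()

module Embedding {m : ℕ} (G : EmbGraph m) where
  open EmbGraph G
  open FaceSet

  φ-injective : Injective _≡_ _≡_ (φ G)
  φ-injective {d} {d′} eq = begin
    d                  ≡⟨ rev-involutive d ⟨
    rev (rev d)        ≡⟨ cong rev (σ⁻¹σ (rev d)) ⟨
    rev (σ⁻¹ (φ G d))  ≡⟨ cong (rev ∘ σ⁻¹) eq ⟩
    rev (σ⁻¹ (φ G d′)) ≡⟨ cong rev (σ⁻¹σ (rev d′)) ⟩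
    rev (rev d′)       ≡⟨ rev-involutive d′ ⟩
    d′                 ∎
    where open ≡-Reasoning

  σ-injective : Injective _≡_ _≡_ σ
  σ-injective {d} {d′} eq = trans (sym (σ⁻¹σ d)) (trans (cong σ⁻¹ eq) (σ⁻¹σ d′))

  degree≡count : ∀ H d → degree G H d ≡ count (λ d′ → sameVertex G d d′ ∧ H (edge d′)) (allDarts m)
  degree≡count H d = length-filter≡count (λ d′ → sameVertex G d d′ ∧ H (edge d′)) (allDarts m)

  IsEven⇔ : ∀ {H} → IsEven G H ⇔ (∀ d → 2 ∣ count (λ d′ → sameVertex G d d′ ∧ H (edge d′)) (allDarts m))
  IsEven⇔ {H} = mk⇔
    (λ even d → subst (2 ∣_) (degree≡count H d) (Equivalence.to (m%n≡0⇔n∣m (degree G H d) 2) (even d)))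
    (λ 2∣ d → Equivalence.from (m%n≡0⇔n∣m (degree G H d) 2) (subst (2 ∣_) (sym (degree≡count H d)) (2∣ d)))

  IsEven-xor : ∀ {H K} → IsEven G H → IsEven G K → IsEven G (λ e → H e xor K e)
  IsEven-xor {H} {K} H-even K-even = Equivalence.from IsEven⇔ λ d →
    subst (2 ∣_) (count-cong (λ d′ → sym (∧-distribˡ-xor (sameVertex G d d′) (H (edge d′)) (K (edge d′))))
                             (allDarts m))
      (count-xor-even _ _ (allDarts m)
        (∣m∣n⇒∣m+n (Equivalence.to IsEven⇔ H-even d) (Equivalence.to IsEven⇔ K-even d)))

  ∂-edge : ∀ W d → ∂ G W (edge d) ≡ mem W d xor mem W (σ d)
  ∂-edge W (e , true)  = cong (mem W (e , true) xor_) (sym (φ-closed W (e , false)))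
  ∂-edge W (e , false) = trans (xor-comm (mem W (e , true)) (mem W (e , false)))
                               (cong (mem W (e , false) xor_) (sym (φ-closed W (e , true))))

  -- Around a vertex the darts of W and those whose σ-successor is in W are equinumerous.
  ∂-even : ∀ W → IsEven G (∂ G W)
  ∂-even W = Equivalence.from IsEven⇔ λ d →
    subst (2 ∣_) (count-cong (rotate d) (allDarts m))
      (count-xor-even (atW d) (atW d ∘ σ) (allDarts m)
        (subst (λ c → 2 ∣ count (atW d) (allDarts m) + c)
          (sym (count-∘-inverse allDarts-unique allDarts-complete σ⁻¹σ σσ⁻¹ (atW d)))
          (2∣n+n (count (atW d) (allDarts m)))))
    where
    atW : Dart m → Dart m → Bool
    atW d x = sameVertex G d x ∧ mem W x

    2∣n+n : ∀ n → 2 ∣ n + n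
    2∣n+n n = subst (2 ∣_) (cong (n +_) (+-identityʳ n)) (m∣m*n n)

    rotate : ∀ d x → atW d x xor atW d (σ x) ≡ sameVertex G d x ∧ ∂ G W (edge x)
    rotate d x = begin
      atW d x xor (sameVertex G d (σ x) ∧ mem W (σ x))
        ≡⟨ cong (λ b → atW d x xor (b ∧ mem W (σ x))) (sameOrbit-π σ-injective d x) ⟩
      atW d x xor (sameVertex G d x ∧ mem W (σ x))
        ≡⟨ ∧-distribˡ-xor (sameVertex G d x) (mem W x) (mem W (σ x)) ⟨
      sameVertex G d x ∧ (mem W x xor mem W (σ x))
        ≡⟨ cong (sameVertex G d x ∧_) (∂-edge W x) ⟨
      sameVertex G d x ∧ ∂ G W (edge x) ∎
      where open ≡-Reasoning

  zipWithᶠ : (f : Bool → Bool → Bool) → f false false ≡ false → FaceSet G → FaceSet G → FaceSet G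
  zipWithᶠ f f₀₀ U V = record
    { mem      = λ d → f (mem U d) (mem V d)
    ; φ-closed = λ d → cong₂ f (φ-closed U d) (φ-closed V d)
    ; no-hole  = trans (cong₂ f (no-hole U) (no-hole V)) f₀₀
    }

  _∪ᶠ_ _∖ᶠ_ _⊕ᶠ_ : FaceSet G → FaceSet G → FaceSet G
  _∪ᶠ_ = zipWithᶠ _∨_ refl
  _∖ᶠ_ = zipWithᶠ (λ u v → not v ∧ u) refl
  _⊕ᶠ_ = zipWithᶠ _xor_ refl

  ∂-⊕ : ∀ U V e → ∂ G (U ⊕ᶠ V) e ≡ ∂ G U e xor ∂ G V e
  ∂-⊕ U V e = xor-interchange (mem U (e , true)) (mem V (e , true)) (mem U (e , false)) (mem V (e , false))

  Homologous-∂ : ∀ {H γ} → Homologous G H γ → ∀ W → Homologous G (λ e → ∂ G W e xor H e) γ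
  Homologous-∂ {H} {γ} (V , H⊕γ≡∂V) W = W ⊕ᶠ V , λ e → begin
    (∂ G W e xor H e) xor oddEdges G γ e ≡⟨ xor-assoc (∂ G W e) (H e) (oddEdges G γ e) ⟩
    ∂ G W e xor (H e xor oddEdges G γ e) ≡⟨ cong (∂ G W e xor_) (H⊕γ≡∂V e) ⟩
    ∂ G W e xor ∂ G V e                  ≡⟨ ∂-⊕ W V e ⟨
    ∂ G (W ⊕ᶠ V) e                       ∎
    where open ≡-Reasoning

  mem⇒AwayFromHole : ∀ U {X} → (∀ e → X e ≡ ∂ G U e) → ∀ {d} → mem U d ≡ true → AwayFromHole G X d
  mem⇒AwayFromHole U X≡∂U U∋d r = contradiction (trans (sym (unreached r)) U∋d) λ ()
    where
    unreached : ∀ {d} → Reach G _ hole d → mem U d ≡ false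
    unreached here                           = no-hole U
    unreached (stepφ {d} r)                  = trans (φ-closed U d) (unreached r)
    unreached (cross {e , true}  r Xe≡false) =
      trans (sym (xor≡false⇒≡ (trans (sym (X≡∂U e)) Xe≡false))) (unreached r)
    unreached (cross {e , false} r Xe≡false) =
      trans (xor≡false⇒≡ (trans (sym (X≡∂U e)) Xe≡false)) (unreached r)

  module _ (X : Subgraph G) where

    Reach-iter : ∀ {s d} → Reach G X s d → ∀ k → Reach G X s (iter (φ G) k d)
    Reach-iter r zero    = r
    Reach-iter r (suc k) = stepφ (Reach-iter r k)

    Reach-φ⁻¹ : ∀ {s d} → Reach G X s (φ G d) → Reach G X s d
    Reach-φ⁻¹ {d = d} r with period (φ G) φ-injective encode-injective d
    ... | q , _ , φᵖd≡d = subst (Reach G X _) (trans (iter-suc (φ G) q d) φᵖd≡d) (Reach-iter r q)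

    Step : Dart m → Dart m → Set
    Step d d′ = d′ ≡ φ G d ⊎ (X (edge d) ≡ false × d′ ≡ rev d)

    Step? : ∀ d d′ → Dec (Step d d′)
    Step? d d′ = (d′ ≟D φ G d) ⊎-dec ((X (edge d) ≟ᵇ false) ×-dec (d′ ≟D rev d))

    Star⇒Reach : ∀ {s d d′} → Reach G X s d → Star Step d d′ → Reach G X s d′
    Star⇒Reach r ε                            = r
    Star⇒Reach r (inj₁ refl              ◅ ss) = Star⇒Reach (stepφ r) ss
    Star⇒Reach r (inj₂ (Xe≡false , refl) ◅ ss) = Star⇒Reach (cross r Xe≡false) ss

    Reach⇒Star : ∀ {s d} → Reach G X s d → Star Step s d
    Reach⇒Star here              = ε
    Reach⇒Star (stepφ r)         = Reach⇒Star r ◅◅ (inj₁ refl ◅ ε)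
    Reach⇒Star (cross r Xe≡false) = Reach⇒Star r ◅◅ (inj₂ (Xe≡false , refl) ◅ ε)

    reach? : ∀ d → Dec (Reach G X hole d)
    reach? d = map′ (Star⇒Reach here) Reach⇒Star (Star-decidable _≟D_ allDarts-complete Step? hole d)

    interior : FaceSet G
    interior = record
      { mem      = λ d → not (does (reach? d))
      ; φ-closed = λ d → cong not (does-⇔ (mk⇔ Reach-φ⁻¹ stepφ) (reach? (φ G d)) (reach? d))
      ; no-hole  = cong not (dec-true (reach? hole) here)
      }

    interior-∋ : ∀ {d} → AwayFromHole G X d → mem interior d ≡ true
    interior-∋ {d} away = cong not (dec-false (reach? d) away)

    ∂-interior-⊆ : ∀ e → X e ≡ false → ∂ G interior e ≡ false
    ∂-interior-⊆ e Xe≡false = trans (cong (λ b → not b xor mem interior (e , false)) same-side)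
                                   (xor-same (mem interior (e , false)))
      where
      same-side : does (reach? (e , true)) ≡ does (reach? (e , false))
      same-side = does-⇔ (mk⇔ (λ r → cross r Xe≡false) (λ r → cross r Xe≡false))
                         (reach? (e , true)) (reach? (e , false))

    closure⇒interior : ∀ {e} → EdgeInClosure G X e → mem interior (e , true) ∨ mem interior (e , false) ≡ true
    closure⇒interior {e} (true  , away) = cong (_∨ mem interior (e , false)) (interior-∋ away)
    closure⇒interior {e} (false , away) =
      trans (cong (mem interior (e , true) ∨_) (interior-∋ away)) (∨-zeroʳ _)

    oddEdges⊆closure : ∀ γ → AllL G (λ d → EdgeInClosure G X (edge d)) (ClosedWalk.darts γ) →
                       ∀ e → oddEdges G γ e ≡ true → EdgeInClosure G X e
    oddEdges⊆closure γ γ⊆ e odd with traversed-or-absent (ClosedWalk.darts γ) γ⊆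
      where
      traversed-or-absent : ∀ ds → AllL G (λ d → EdgeInClosure G X (edge d)) ds →
                            EdgeInClosure G X e ⊎ length (filter (λ d → edge d ≟ᶠ e) ds) ≡ 0
      traversed-or-absent []       []         = inj₂ refl
      traversed-or-absent (d ∷ ds) (d∈ ∷ ds∈) with edge d ≟ᶠ e
      ... | yes refl = inj₁ d∈
      ... | no  _    = traversed-or-absent ds ds∈
    ... | inj₁ e∈   = e∈
    ... | inj₂ none = contradiction (trans (sym (cong (λ n → does (n % 2 Data.Nat.≟ 1)) none)) odd) λ ()

  module Exchange {X : Subgraph G} {γ : ClosedWalk G} {H : Subgraph G}
                  (γ⊆ : AllL G (λ d → EdgeInClosure G X (edge d)) (ClosedWalk.darts γ))
                  (V : FaceSet G) (H⊕γ≡∂V : ∀ e → H e xor oddEdges G γ e ≡ ∂ G V e) where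

    A B W : FaceSet G
    A = interior X
    B = A ∪ᶠ V
    W = V ∖ᶠ A

    private
      H≡∂V⊕γ : ∀ e → H e ≡ ∂ G V e xor oddEdges G γ e
      H≡∂V⊕γ e = xor-cancelʳ (H e) (oddEdges G γ e) (∂ G V e) (H⊕γ≡∂V e)

      γ⊆A : ∀ e → oddEdges G γ e ≡ true → mem A (e , true) ∨ mem A (e , false) ≡ true
      γ⊆A e odd = closure⇒interior X (oddEdges⊆closure X γ γ⊆ e odd)

    exchange-weight : weight G (∂ G B) +ℚ weight G (λ e → ∂ G W e xor H e) ≤ℚ weight G X +ℚ weight G H
    exchange-weight = wsum-exchange w w≥0 {∂ G B} {λ e → ∂ G W e xor H e} {X} {H} (λ e →
      exchange-cost (mem A (e , true)) (mem A (e , false)) (mem V (e , true)) (mem V (e , false))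
                    (oddEdges G γ e) (X e) (H e) (H≡∂V⊕γ e) (∂-interior-⊆ X e) (γ⊆A e)) (allFin m)

    H⊆closure : SubgraphInClosure G (∂ G B) H
    H⊆closure e He
      with some-side (mem A (e , true)) (mem A (e , false)) (mem V (e , true)) (mem V (e , false))
                     (oddEdges G γ e) (γ⊆A e) (trans (sym (H≡∂V⊕γ e)) He)
    ... | inj₁ B∋eᵗ = true  , mem⇒AwayFromHole B (λ _ → refl) B∋eᵗ
    ... | inj₂ B∋eᶠ = false , mem⇒AwayFromHole B (λ _ → refl) B∋eᶠ

lemma7p5 : {m : ℕ} (G : EmbGraph m) (X : Subgraph G) (γ : ClosedWalk G) (H : Subgraph G) →
    IsMinSeparating G X →
    WalkInClosure G X γ →
    IsMinEvenHomologous G H γ →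
    Σ (Subgraph G) λ X' → IsMinSeparating G X' × SubgraphInClosure G X' H
lemma7p5 G X γ H ((U , (d₀ , U∋d₀) , X≡∂U) , X-min) (_ , γ⊆) (H-even , H∼γ@(V , H⊕γ≡∂V) , H-min) =
  ∂ G B , (B-separating , ∂B-min) , H⊆closure
  where
  open Embedding G
  open Exchange {X} {γ} {H} γ⊆ V H⊕γ≡∂V

  B-separating : IsSeparating G (∂ G B)
  B-separating = B , (d₀ , cong (_∨ FaceSet.mem V d₀) (interior-∋ X (mem⇒AwayFromHole U X≡∂U U∋d₀))) , λ _ → refl

  ∂B-min : ∀ Y → IsSeparating G Y → weight G (∂ G B) ≤ℚ weight G Y
  ∂B-min Y Y-separating = ℚ.≤-trans (+-cancelʳ-≤ _ _ _ (ℚ.≤-trans exchange-weight (ℚ.+-monoʳ-≤ (weight G X)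
      (H-min _ (IsEven-xor (∂-even W) H-even) (Homologous-∂ {γ = γ} H∼γ W)))))
    (X-min Y Y-separating)
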